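{- Let $G$ be a connected graph of order $n\ge2$ and let $H$ be a graph of order at least two. In $G\odot H$, for $i\in\{1,\dots,n\}$ let $H_i$ be the $i$-th copy of $H$ with vertex set $V_i$. (i) If $S$ is a zero forcing set of $G\odot H$, then $V_i\cap S\neq\emptyset$ for every $i\in\{1,\dots,n\}$. (ii) If $H$ is connected and $S$ is a zero forcing set of $G\odot H$, then for every $i\in\{1,\dots,n\}$, $S\cap V_i$ is a zero forcing set of $H_i$.
   Context: Zero forcing: given a set $S$ of initially black vertices (others white), the color-change rule turns a white vertex black if it is the only white neighbor of some black vertex; $S$ is a zero forcing set if eventually all vertices become black. Corona: for $G$ with vertices $v_1,\dots,v_n$, $G\odot H$ is obtained from $G$ and $n$ disjoint copies $H_1,\dots,H_n$ of $H$ by joining $v_i$ to every vertex of $H_i$. -}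

module Defs where

open import Data.Nat using (ℕ)
open import Data.Fin using (Fin)
open import Data.Fin.Properties using (_≟_)
open import Data.Bool using (Bool; true; false; _∧_)
open import Data.Bool.Properties using (∧-comm)
open import Data.Sum using (_⊎_; inj₁; inj₂)
open import Data.Product using (_×_; _,_)
open import Relation.Nullary using (does; yes; no)
open import Relation.Binary.PropositionalEquality
  using (_≡_; _≢_; refl; sym; cong)

record Graph (V : Set) : Set where
  field
    adj   : V → V → Bool
    adj-sym : ∀ u v → adj u v ≡ adj v u
    irrefl : ∀ v → adj v v ≡ false
open Graph public

data Reach {V : Set} (G : Graph V) : V → V → Set where
  here : ∀ {u} → Reach G u u
  step : ∀ {u v w} → adj G u v ≡ true → Reach G v w → Reach G u w

Connected : {V : Set} → Graph V → Set
Connected {V} G = ∀ (u v : V) → Reach G u v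

Subset : Set → Set
Subset V = V → Bool

-- Since the rule is monotone, this inductive
-- closure is exactly the final set of black vertices of the forcing process.
data Black {V : Set} (G : Graph V) (S : Subset V) : V → Set where
  init  : ∀ {v} → S v ≡ true → Black G S v
  force : ∀ {u w} → Black G S u → adj G u w ≡ true →
          (∀ x → adj G u x ≡ true → x ≢ w → Black G S x) → Black G S w

IsZeroForcingSet : {V : Set} → Graph V → Subset V → Set
IsZeroForcingSet {V} G S = ∀ (v : V) → Black G S v

-- Corona G ⊙ H for G on Fin n and H on Fin m.
-- Vertex inj₁ i is v_i of G; vertex inj₂ (i , x) is vertex x of the copy H_i.
CVertex : ℕ → ℕ → Set
CVertex n m = Fin n ⊎ (Fin n × Fin m)

private
  ≟-sym : ∀ {n} (i j : Fin n) → does (i ≟ j) ≡ does (j ≟ i)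
  ≟-sym i j with i ≟ j | j ≟ i
  ... | yes _ | yes _ = refl
  ... | no _  | no _  = refl
  ... | yes p | no q  with q (sym p)
  ... | ()
  ≟-sym i j | no q | yes p with q (sym p)
  ... | ()

  ≟-refl : ∀ {n} (i : Fin n) → does (i ≟ i) ≡ true
  ≟-refl i with i ≟ i
  ... | yes _ = refl
  ... | no q with q refl
  ... | ()

corona : ∀ {n m} → Graph (Fin n) → Graph (Fin m) → Graph (CVertex n m)
corona {n} {m} G H = record { adj = a ; adj-sym = s ; irrefl = r }
  where
  a : CVertex n m → CVertex n m → Bool
  a (inj₁ i) (inj₁ j) = adj G i j
  a (inj₁ i) (inj₂ (j , y)) = does (i ≟ j)
  a (inj₂ (i , x)) (inj₁ j) = does (i ≟ j)
  a (inj₂ (i , x)) (inj₂ (j , y)) = does (i ≟ j) ∧ adj H x y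

  s : ∀ u v → a u v ≡ a v u
  s (inj₁ i) (inj₁ j) = adj-sym G i j
  s (inj₁ i) (inj₂ (j , y)) = ≟-sym i j
  s (inj₂ (i , x)) (inj₁ j) = ≟-sym i j
  s (inj₂ (i , x)) (inj₂ (j , y)) rewrite ≟-sym i j | adj-sym H x y = refl

  r : ∀ v → a v v ≡ false
  r (inj₁ i) = irrefl G i
  r (inj₂ (i , x)) rewrite ≟-refl i = irrefl H x

-- S ∩ V_i, viewed as a subset of H (H_i identified with H via x ↦ (i , x)).
restrict : ∀ {n m} → Subset (CVertex n m) → Fin n → Subset (Fin m)
restrict S i x = S (inj₂ (i , x))

module Submission where

-- The only neighbours in G ⊙ H of a vertex (i , x) of the copy H_i are the hub
-- v_i and the H-neighbours (i , y) of x inside H_i (the view 'CopyForcer').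
-- So in any derivation that (i , x) becomes black, the last force came either
-- from inside H_i, or from v_i — and v_i can only force (i , x) once every
-- other vertex of H_i, all of which are its neighbours, is already black.
-- Induction on the derivation then gives both parts of the theorem:
--   (i)  a black vertex of H_i is eventually traced back to an initial black
--        vertex of H_i ('copyMeetsSeed'), since H_i has a second vertex;
--   (ii) every force of the corona into H_i is replayed inside H itself
--        ('copyBlackInH'); a force by v_i is replaced by the general fact that
--        in a connected graph with at least two vertices, a vertex is forced as
--        soon as all the other vertices are black ('lastVertexForced').

open import Defs
open import Data.Nat using (ℕ; _≥_; s≤s; z≤n)
open import Data.Fin using (Fin; zero; suc)
open import Data.Fin.Properties using (_≟_)
open import Data.Bool using (true; _∧_)
open import Data.Product using (Σ; _×_; _,_)
open import Data.Sum using (inj₁; inj₂)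
open import Data.Empty using (⊥-elim)
open import Relation.Nullary using (yes; no)
open import Relation.Nullary.Decidable using (dec-true)
open import Relation.Binary.PropositionalEquality
  using (_≡_; _≢_; refl; sym; trans; subst)

module _ {V : Set} (H : Graph V) where

  adj⇒≢ : ∀ {x z} → adj H x z ≡ true → z ≢ x
  adj⇒≢ {x} a refl with trans (sym a) (irrefl H x)
  ... | ()

  neighbourOnWalk : ∀ {x y} → y ≢ x → Reach H x y → Σ V (λ z → adj H x z ≡ true)
  neighbourOnWalk y≢x here = ⊥-elim (y≢x refl)
  neighbourOnWalk _ (step {v = z} a _) = z , a

  -- If every vertex other than x is black and x has a neighbour z, then z,
  -- whose only possibly white neighbour is x, forces x.
  lastVertexForced : ∀ (R : Subset V) {x z} → adj H x z ≡ true →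
    (∀ y → y ≢ x → Black H R y) → Black H R x
  lastVertexForced R {x} {z} a othersBlack =
    force (othersBlack z (adj⇒≢ a)) (trans (adj-sym H z x) a)
          (λ y _ y≢x → othersBlack y y≢x)

  lastVertexForcedConnected : Connected H → ∀ (R : Subset V) {x y} → y ≢ x →
    (∀ w → w ≢ x → Black H R w) → Black H R x
  lastVertexForcedConnected conn R {x} {y} y≢x othersBlack
    with neighbourOnWalk y≢x (conn x y)
  ... | z , a = lastVertexForced R a othersBlack

anotherVertex : ∀ {m} → m ≥ 2 → (x : Fin m) → Σ (Fin m) (λ y → y ≢ x)
anotherVertex (s≤s (s≤s z≤n)) zero    = suc zero , λ ()
anotherVertex (s≤s (s≤s z≤n)) (suc x) = zero , λ ()

module _ {n m : ℕ} (G : Graph (Fin n)) (H : Graph (Fin m)) where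

  C : Graph (CVertex n m)
  C = corona G H

  data CopyForcer (i : Fin n) (x : Fin m) : CVertex n m → Set where
    hub     : CopyForcer i x (inj₁ i)
    sibling : ∀ {y} → adj H y x ≡ true → CopyForcer i x (inj₂ (i , y))

  copyForcer : ∀ {u i x} → adj C u (inj₂ (i , x)) ≡ true → CopyForcer i x u
  copyForcer {inj₁ j} {i} a with j ≟ i | a
  ... | yes refl | _ = hub
  ... | no _     | ()
  copyForcer {inj₂ (j , y)} {i} a with j ≟ i | a
  ... | yes refl | a′ = sibling a′
  ... | no _     | ()

  hubAdj : ∀ i y → adj C (inj₁ i) (inj₂ (i , y)) ≡ true
  hubAdj i y = dec-true (i ≟ i) refl

  siblingAdj : ∀ i {y z} → adj H y z ≡ true → adj C (inj₂ (i , y)) (inj₂ (i , z)) ≡ true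
  siblingAdj i {y} {z} a = subst (λ b → b ∧ adj H y z ≡ true) (sym (dec-true (i ≟ i) refl)) a

  copy-≢ : ∀ {i : Fin n} {y x : Fin m} → y ≢ x →
    _≢_ {A = CVertex n m} (inj₂ (i , y)) (inj₂ (i , x))
  copy-≢ y≢x refl = y≢x refl

  module _ (m≥2 : m ≥ 2) (S : Subset (CVertex n m)) where

    copyMeetsSeed : ∀ {i x} → Black C S (inj₂ (i , x)) →
      Σ (Fin m) (λ y → S (inj₂ (i , y)) ≡ true)
    copyMeetsSeed {x = x} (init s) = x , s
    copyMeetsSeed {i} {x} (force {u} _ a othersBlack) with copyForcer {u} {i} {x} a
    ... | hub with anotherVertex m≥2 x
    ...   | y , y≢x = copyMeetsSeed (othersBlack (inj₂ (i , y)) (hubAdj i y) (copy-≢ y≢x))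
    copyMeetsSeed (force forcer _ _) | sibling _ = copyMeetsSeed forcer

    copyBlackInH : Connected H → ∀ {i x} → Black C S (inj₂ (i , x)) →
      Black H (restrict S i) x
    copyBlackInH _ (init s) = init s
    copyBlackInH conn {i} {x} (force {u} _ a othersBlack) with copyForcer {u} {i} {x} a
    ... | hub with anotherVertex m≥2 x
    ...   | _ , y≢x = lastVertexForcedConnected H conn (restrict S i) y≢x
            (λ z z≢x → copyBlackInH conn (othersBlack (inj₂ (i , z)) (hubAdj i z) (copy-≢ z≢x)))
    copyBlackInH conn {i} (force forcer _ othersBlack) | sibling a =
      force (copyBlackInH conn forcer) a
        (λ z yz z≢x → copyBlackInH conn (othersBlack (inj₂ (i , z)) (siblingAdj i yz) (copy-≢ z≢x)))

mainTheorem10 : ∀ {n m : ℕ} (G : Graph (Fin n)) (H : Graph (Fin m)) →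
    n ≥ 2 → Connected G → m ≥ 2 →
    ((S : Subset (CVertex n m)) → IsZeroForcingSet (corona G H) S →
       (i : Fin n) → Σ (Fin m) (λ x → S (inj₂ (i , x)) ≡ true))
    × (Connected H → (S : Subset (CVertex n m)) →
       IsZeroForcingSet (corona G H) S →
       (i : Fin n) → IsZeroForcingSet H (restrict S i))
mainTheorem10 G H _ _ m≥2@(s≤s _) =
  (λ S zfs i → copyMeetsSeed G H m≥2 S (zfs (inj₂ (i , zero))))
  , (λ conn S zfs i x → copyBlackInH G H m≥2 S conn (zfs (inj₂ (i , x))))
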